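{- Let $\mathbf{S}$ be a hereditary closed set of positions of a ruleset such that, for every position $G\in\mathbf{S}$, every pair $(G^L,G^R)\in G^{\mathcal{L}}\times G^{\mathcal{R}}$ satisfies the F2 property. Then, for every position $G\in\mathbf{S}$, every pair $(G^L,G^R)\in G^{\mathcal{L}}\times G^{\mathcal{R}}$ satisfies the F1 property.
   Context: We work in normal-play combinatorial game theory with short partizan games and the usual partial order $\leqslant$ on game values. For a position $G$, $G^{\mathcal{L}}$ and $G^{\mathcal{R}}$ denote its sets of Left and Right options; for an option $G^L$, $G^{L\mathcal{R}}$ denotes the set of Right options of $G^L$, and for $G^R$, $G^{R\mathcal{L}}$ denotes the set of Left options of $G^R$. A set $\mathbf{S}$ of positions is a hereditary closed set of positions of a ruleset (HCR) if it is closed under taking options. For $G\in\mathbf{S}$, a pair $(G^L,G^R)\in G^{\mathcal{L}}\times G^{\mathcal{R}}$ satisfies the F1 property if there is $G^{RL}\in G^{R\mathcal{L}}$ with $G^{RL}\geqslant G^L$, or there is $G^{LR}\in G^{L\mathcal{R}}$ with $G^{LR}\leqslant G^R$. The pair satisfies the F2 property if there are $G^{LR}\in G^{L\mathcal{R}}$ and $G^{RL}\in G^{R\mathcal{L}}$ with $G^{RL}\geqslant G^{LR}$. -}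

module Defs where

open import Data.Bool using (Bool; true; false; not; _∧_; _∨_; T)
open import Data.List using (List; []; _∷_)
open import Data.List.Membership.Propositional using (_∈_)
open import Data.Product using (Σ; ∃; _×_; _,_)
open import Data.Sum using (_⊎_)

data Game : Set where
  mk : List Game → List Game → Game

Lopts : Game → List Game
Lopts (mk L _) = L

Ropts : Game → List Game
Ropts (mk _ R) = R

mutual
  le : Game → Game → Bool
  le (mk GL GR) (mk HL HR) = not (anyGe GL (mk HL HR)) ∧ not (anyLe HR (mk GL GR))

  anyGe : List Game → Game → Bool
  anyGe [] H = false
  anyGe (x ∷ xs) H = le H x ∨ anyGe xs H

  anyLe : List Game → Game → Bool
  anyLe [] G = false
  anyLe (y ∷ ys) G = le y G ∨ anyLe ys G

infix 4 _≤_ _≥_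
_≤_ : Game → Game → Set
G ≤ H = T (le G H)

_≥_ : Game → Game → Set
G ≥ H = H ≤ G

HereditaryClosed : (Game → Set) → Set
HereditaryClosed S =
  ∀ G → S G → (∀ GL → GL ∈ Lopts G → S GL) × (∀ GR → GR ∈ Ropts G → S GR)

F1 : Game → Game → Set
F1 GL GR =
  (Σ Game λ GRL → GRL ∈ Lopts GR × GRL ≥ GL)
  ⊎ (Σ Game λ GLR → GLR ∈ Ropts GL × GLR ≤ GR)

F2 : Game → Game → Set
F2 GL GR =
  Σ Game λ GLR → Σ Game λ GRL →
    GLR ∈ Ropts GL × GRL ∈ Lopts GR × GRL ≥ GLR

{-# OPTIONS --safe #-}
module Submission where

-- F1 for a pair (G^L, G^R) says exactly that G^R ≤ G^L fails.  When F2 holds throughout S,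
-- induction on positions shows that every G in S lies between its options, G^L ≤ G ≤ G^R.
-- Hence G^R ≤ G^L would give G^{LR} ≤ G^{RL} ≤ G^R ≤ G^L, contradicting G^{LR} ≰ G^L.

open import Data.Bool using (true; false; not; _∨_; T)
open import Data.Bool.ListAction using (any)
open import Data.Bool.Properties using (T-∧)
open import Data.Empty using (⊥-elim)
open import Data.List using ([]; _∷_)
open import Data.List.Membership.Propositional using (_∈_; find; lose)
open import Data.List.Relation.Unary.Any using (Any; here; there; any?)
open import Data.List.Relation.Unary.Any.Properties using (any⇔)
open import Data.Product using (_×_; _,_; proj₁; proj₂)
open import Data.Product.Function.NonDependent.Propositional using (_×-⇔_)
open import Data.Sum as Sum using (_⊎_; inj₁; inj₂)
open import Function using (_∘_; _⇔_; mk⇔; Equivalence)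
import Function.Properties.Equivalence as ⇔
open import Function.Related.TypeIsomorphisms using (¬-cong-⇔)
open import Induction.WellFounded using (WellFounded; Acc; acc)
open import Relation.Nullary using (¬_; yes; no)
open import Relation.Nullary.Decidable using (T?)
open import Relation.Binary.PropositionalEquality using (_≡_; refl; cong)

open import Defs

data _⊏_ : Game → Game → Set where
  left  : ∀ {x G} → x ∈ Lopts G → x ⊏ G
  right : ∀ {y G} → y ∈ Ropts G → y ⊏ G

⊏-wellFounded : WellFounded _⊏_
⊏-wellFounded (mk L R) = acc λ { (left x∈) → accessible L x∈ ; (right y∈) → accessible R y∈ }
  where
  accessible : ∀ {x} xs → x ∈ xs → Acc _⊏_ x
  accessible (x ∷ xs) (here refl) = ⊏-wellFounded x
  accessible (_ ∷ xs) (there x∈) = accessible xs x∈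

T-not : ∀ {b} → T (not b) ⇔ (¬ T b)
T-not {false} = mk⇔ (λ _ ()) (λ _ → _)
T-not {true}  = mk⇔ (λ ()) (λ ¬⊤ → ¬⊤ _)

anyGe≡any : ∀ xs H → anyGe xs H ≡ any (le H) xs
anyGe≡any []       H = refl
anyGe≡any (x ∷ xs) H = cong (le H x ∨_) (anyGe≡any xs H)

anyLe≡any : ∀ ys G → anyLe ys G ≡ any (λ y → le y G) ys
anyLe≡any []       G = refl
anyLe≡any (y ∷ ys) G = cong (le y G ∨_) (anyLe≡any ys G)

T-anyGe : ∀ xs H → T (anyGe xs H) ⇔ Any (H ≤_) xs
T-anyGe xs H rewrite anyGe≡any xs H = ⇔.sym any⇔

T-anyLe : ∀ ys G → T (anyLe ys G) ⇔ Any (_≤ G) ys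
T-anyLe ys G rewrite anyLe≡any ys G = ⇔.sym any⇔

≤⇔ : ∀ G H → G ≤ H ⇔ (¬ Any (H ≤_) (Lopts G) × ¬ Any (_≤ G) (Ropts H))
≤⇔ G@(mk GL GR) H@(mk HL HR) = ⇔.trans T-∧
  (⇔.trans T-not (¬-cong-⇔ (T-anyGe GL H)) ×-⇔ ⇔.trans T-not (¬-cong-⇔ (T-anyLe HR G)))

≤-intro : ∀ G H → (∀ {x} → x ∈ Lopts G → ¬ H ≤ x) → (∀ {y} → y ∈ Ropts H → ¬ y ≤ G) → G ≤ H
≤-intro G H ⋡ ⋠ = Equivalence.from (≤⇔ G H)
  ( (λ p → let _ , x∈ , H≤x = find p in ⋡ x∈ H≤x)
  , (λ p → let _ , y∈ , y≤G = find p in ⋠ y∈ y≤G))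

≤-left : ∀ G H {x} → G ≤ H → x ∈ Lopts G → ¬ H ≤ x
≤-left G H G≤H x∈ H≤x = proj₁ (Equivalence.to (≤⇔ G H) G≤H) (lose x∈ H≤x)

≤-right : ∀ G H {y} → G ≤ H → y ∈ Ropts H → ¬ y ≤ G
≤-right G H G≤H y∈ y≤G = proj₂ (Equivalence.to (≤⇔ G H) G≤H) (lose y∈ y≤G)

≰⇒ : ∀ G H → ¬ G ≤ H → Any (H ≤_) (Lopts G) ⊎ Any (_≤ G) (Ropts H)
≰⇒ G H G≰H with any? (λ x → T? (le H x)) (Lopts G) | any? (λ y → T? (le y G)) (Ropts H)
... | yes p | _     = inj₁ p
... | no _  | yes q = inj₂ q
... | no ¬p | no ¬q = ⊥-elim (G≰H (Equivalence.from (≤⇔ G H) (¬p , ¬q)))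

≤-refl-acc : ∀ {G} → Acc _⊏_ G → G ≤ G
≤-refl-acc {G} (acc rs) = ≤-intro G G
  (λ {x} x∈ G≤x → ≤-left G x G≤x x∈ (≤-refl-acc (rs (left x∈))))
  (λ {y} y∈ y≤G → ≤-right y G y≤G y∈ (≤-refl-acc (rs (right y∈))))

≤-refl : ∀ G → G ≤ G
≤-refl G = ≤-refl-acc (⊏-wellFounded G)

≤-trans-acc : ∀ {X Y Z} → Acc _⊏_ X → Acc _⊏_ Y → Acc _⊏_ Z → X ≤ Y → Y ≤ Z → X ≤ Z
≤-trans-acc {X} {Y} {Z} (acc rx) accY (acc rz) X≤Y Y≤Z = ≤-intro X Z
  (λ x∈ Z≤x → ≤-left X Y X≤Y x∈ (≤-trans-acc accY (acc rz) (rx (left x∈)) Y≤Z Z≤x))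
  (λ z∈ z≤X → ≤-right Y Z Y≤Z z∈ (≤-trans-acc (rz (right z∈)) (acc rx) accY z≤X X≤Y))

≤-trans : ∀ X Y Z → X ≤ Y → Y ≤ Z → X ≤ Z
≤-trans X Y Z = ≤-trans-acc (⊏-wellFounded X) (⊏-wellFounded Y) (⊏-wellFounded Z)

leftOption-⋡ : ∀ G {x} → x ∈ Lopts G → ¬ G ≤ x
leftOption-⋡ G = ≤-left G G (≤-refl G)

rightOption-⋠ : ∀ G {y} → y ∈ Ropts G → ¬ y ≤ G
rightOption-⋠ G = ≤-right G G (≤-refl G)

LeftOptionsBelow : Game → Set
LeftOptionsBelow G = ∀ {x} → x ∈ Lopts G → x ≤ G

RightOptionsAbove : Game → Set
RightOptionsAbove G = ∀ {y} → y ∈ Ropts G → G ≤ y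

leftOption-≤ : ∀ G {x} → x ∈ Lopts G → LeftOptionsBelow x →
               (∀ {y} → y ∈ Ropts G → ¬ y ≤ x) → x ≤ G
leftOption-≤ G {x} x∈ below ⋠ = ≤-intro x G
  (λ {xl} xl∈ G≤xl → leftOption-⋡ G x∈ (≤-trans G xl x G≤xl (below xl∈))) ⋠

rightOption-≥ : ∀ G {y} → y ∈ Ropts G → RightOptionsAbove y →
                (∀ {x} → x ∈ Lopts G → ¬ y ≤ x) → G ≤ y
rightOption-≥ G {y} y∈ above ⋡ = ≤-intro G y ⋡
  (λ {yr} yr∈ yr≤G → rightOption-⋠ G y∈ (≤-trans y yr G (above yr∈) yr≤G))

F2⇒⋠ : ∀ GL GR → F2 GL GR → LeftOptionsBelow GR → ¬ GR ≤ GL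
F2⇒⋠ GL GR (GLR , GRL , GLR∈ , GRL∈ , GLR≤GRL) below GR≤GL =
  rightOption-⋠ GL GLR∈ (≤-trans GLR GRL GL GLR≤GRL (≤-trans GRL GR GL (below GRL∈) GR≤GL))

⋠⇒F1 : ∀ GL GR → ¬ GR ≤ GL → F1 GL GR
⋠⇒F1 GL GR = Sum.map find find ∘ ≰⇒ GR GL

module _ (S : Game → Set) (closed : HereditaryClosed S)
         (allF2 : ∀ G → S G → ∀ GL GR → GL ∈ Lopts G → GR ∈ Ropts G → F2 GL GR) where

  betweenOptions : ∀ {G} → Acc _⊏_ G → S G → LeftOptionsBelow G × RightOptionsAbove G
  betweenOptions {G} (acc rs) sG = below , above
    where
    leftIH : ∀ {x} → x ∈ Lopts G → LeftOptionsBelow x × RightOptionsAbove x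
    leftIH x∈ = betweenOptions (rs (left x∈)) (proj₁ (closed G sG) _ x∈)

    rightIH : ∀ {y} → y ∈ Ropts G → LeftOptionsBelow y × RightOptionsAbove y
    rightIH y∈ = betweenOptions (rs (right y∈)) (proj₂ (closed G sG) _ y∈)

    separated : ∀ {x y} → x ∈ Lopts G → y ∈ Ropts G → ¬ y ≤ x
    separated {x} {y} x∈ y∈ = F2⇒⋠ x y (allF2 G sG x y x∈ y∈) (proj₁ (rightIH y∈))

    below : LeftOptionsBelow G
    below x∈ = leftOption-≤ G x∈ (proj₁ (leftIH x∈)) (separated x∈)

    above : RightOptionsAbove G
    above y∈ = rightOption-≥ G y∈ (proj₂ (rightIH y∈)) (λ x∈ → separated x∈ y∈)

mainTheorem3 : (S : Game → Set) → HereditaryClosed S →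
    (∀ G → S G → ∀ GL GR → GL ∈ Lopts G → GR ∈ Ropts G → F2 GL GR) →
    ∀ G → S G → ∀ GL GR → GL ∈ Lopts G → GR ∈ Ropts G → F1 GL GR
mainTheorem3 S closed allF2 G sG GL GR GL∈ GR∈ =
  ⋠⇒F1 GL GR (F2⇒⋠ GL GR (allF2 G sG GL GR GL∈ GR∈) GR-leftOptionsBelow)
  where
  GR-leftOptionsBelow : LeftOptionsBelow GR
  GR-leftOptionsBelow =
    proj₁ (betweenOptions S closed allF2 (⊏-wellFounded GR) (proj₂ (closed G sG) GR GR∈))
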